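{- Let $Q$ be a finite quiver with no oriented cycles. Then there exists a finite quiver $R$ such that $R$ is mutation equivalent to a bipartite quiver and $Q$ is (isomorphic to) a full subquiver of $R$.
   Context: A quiver $Q=(Q_0,Q_1,t,h)$ is a finite oriented graph with vertex set $Q_0$, arrow set $Q_1$ (multiple arrows allowed), and maps $t,h:Q_1\to Q_0$ giving the tail and head of each arrow. Quivers subject to mutation are assumed to have no loops and no oriented $2$-cycles. The mutation of a quiver at a vertex $k$ (Fomin–Zelevinsky) is the quiver obtained by: (1) for every pair of arrows $i\to k$ and $k\to j$, adding a new arrow $i\to j$; (2) reversing all arrows incident to $k$; (3) removing a maximal collection of pairwise disjoint oriented $2$-cycles. Two quivers are mutation equivalent if one can be obtained from the other by a finite sequence of mutations (up to isomorphism). A quiver $Q$ is a full subquiver of $R$ if $Q_0\subseteq R_0$ and the arrows of $Q$ are exactly the arrows of $R$ both of whose endpoints lie in $Q_0$. A quiver is bipartite if every vertex is a source or a sink, i.e. it has no oriented path of length $2$. -}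

module Defs where

open import Data.Nat using (ℕ; _+_; _*_; _∸_; _<_)
open import Data.Fin using (Fin; _≟_)
open import Data.Sum using (_⊎_)
open import Data.Product using (Σ; _×_)
open import Relation.Nullary using (¬_; yes; no)
open import Relation.Binary.PropositionalEquality using (_≡_)
open import Function.Bundles using (_↔_; Inverse)
open import Function.Definitions using (Injective)

-- A finite quiver on the vertex set Fin n, recorded (up to isomorphism)
-- by its arrow multiplicities: Q i j = number of arrows i → j.
Quiver : ℕ → Set
Quiver n = Fin n → Fin n → ℕ

data Path {n : ℕ} (Q : Quiver n) : Fin n → Fin n → Set where
  edge : ∀ {i j} → 0 < Q i j → Path Q i j
  cons : ∀ {i j k} → 0 < Q i j → Path Q j k → Path Q i k

Acyclic : ∀ {n} → Quiver n → Set
Acyclic {n} Q = (i : Fin n) → ¬ Path Q i i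

Bipartite : ∀ {n} → Quiver n → Set
Bipartite {n} Q = (i j k : Fin n) → (Q i j ≡ 0) ⊎ (Q j k ≡ 0)

-- For i, j ≠ k the number of arrows i → j
-- after steps (1) and (2) is a = Q i j + Q i k * Q k j, the number j → i is
-- b = Q j i + Q j k * Q k i; removing a maximal set of disjoint 2-cycles
-- leaves a ∸ b arrows i → j.
mutate : ∀ {n} → Fin n → Quiver n → Quiver n
mutate k Q i j with i ≟ k | j ≟ k
... | yes _ | _     = Q j i
... | no _  | yes _ = Q j i
... | no _  | no _  = (Q i j + Q i k * Q k j) ∸ (Q j i + Q j k * Q k i)

Iso : ∀ {n m} → Quiver n → Quiver m → Set
Iso {n} {m} Q R = Σ (Fin n ↔ Fin m) λ σ →
  (i j : Fin n) → Q i j ≡ R (Inverse.to σ i) (Inverse.to σ j)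

data MutEquiv {n : ℕ} (Q : Quiver n) : Quiver n → Set where
  same    : MutEquiv Q Q
  mutStep : ∀ {R} (k : Fin n) → MutEquiv Q R → MutEquiv Q (mutate k R)
  isoStep : ∀ {R S} → MutEquiv Q R → Iso R S → MutEquiv Q S

FullSubquiver : ∀ {n m} → Quiver n → Quiver m → Set
FullSubquiver {n} {m} Q R = Σ (Fin n → Fin m) λ f →
  Injective _≡_ _≡_ f × ((i j : Fin n) → Q i j ≡ R (f i) (f j))

module Submission where

-- Take 2n vertices: a copy V a of each vertex of Q and a "frozen"
-- partner G a.  The bipartite quiver B has Q a l arrows V a → G l for a ≠ l and
-- one frame arrow V l → G l; all arrows go from the copies to the frozen vertices.
-- Choose the vertices of Q one at a time, always a source of the part of Q not yet
-- chosen (acyclicity guarantees one exists), and mutate at G j and then at V j.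
-- The first mutation composes the frame arrow V j → G j with the arrows leaving G j,
-- the second reverses the arrows at V j; the net effect is that the arrows between
-- V j and the copies of the already chosen vertices become exactly those of Q.

open import Defs
open import Data.Nat using (ℕ; zero; suc; _+_; _*_; _∸_; _<_; _<?_) renaming (_≟_ to _≟ℕ_)
open import Data.Nat.Properties using (n≢0⇒n>0; *-zeroʳ; *-identityˡ; +-identityʳ; 0∸n≡0; m<1+n⇒m<n∨m≡n; n<1+n)
open import Data.Fin using (Fin; toℕ; _↑ˡ_; _↑ʳ_; splitAt; _≟_)
open import Data.Fin.Properties using (↑ˡ-injective; ↑ʳ-injective; splitAt-↑ˡ; splitAt-↑ʳ; any?; pigeonhole)
open import Data.Fin.Subset using (Subset; _∈_; _∉_; _∪_; ⁅_⁆; ∁; _⊃_; Nonempty; Empty) renaming (⊥ to ∅)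
open import Data.Fin.Subset.Properties using (_∈?_; nonempty?; ∉⊥; x∈p∪q⁻; x∈p∪q⁺; p⊆p∪q; x∈⁅x⁆; x∈⁅y⁆⇒x≡y; x∈∁p⇒x∉p; x∉p⇒x∈∁p; x∉∁p⇒x∈p)
open import Data.Fin.Subset.Induction using (⊃-wellFounded; Acc; acc)
open import Data.Sum using (_⊎_; inj₁; inj₂; swap) renaming (map to ⊎-map; map₂ to ⊎-map₂)
open import Data.Product using (Σ; ∃; ∃₂; _×_; _,_; proj₁; proj₂)
open import Data.Empty using (⊥; ⊥-elim)
open import Relation.Nullary using (¬_; Dec; yes; no; ¬?; contradiction)
open import Relation.Nullary.Decidable using (_×-dec_; decidable-stable)
open import Relation.Binary.PropositionalEquality using (_≡_; _≢_; refl; sym; trans; cong; cong₂; subst; module ≡-Reasoning)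
open ≡-Reasoning

OneWay : ∀ {m} → Quiver m → Fin m → Fin m → Set
OneWay R a b = R a b ≡ 0 ⊎ R b a ≡ 0

NoPathVia : ∀ {m} → Quiver m → Fin m → Fin m → Fin m → Set
NoPathVia R a k b = R a k ≡ 0 ⊎ R k b ≡ 0

noPath⇒no-composites : ∀ {m} (R : Quiver m) (a k b : Fin m) →
  NoPathVia R a k b → R a k * R k b ≡ 0
noPath⇒no-composites R a k b (inj₁ ak≡0) = cong (_* R k b) ak≡0
noPath⇒no-composites R a k b (inj₂ kb≡0) = trans (cong (R a k *_) kb≡0) (*-zeroʳ (R a k))

oneWay-cancel : ∀ u v → u ≡ 0 ⊎ v ≡ 0 → u ∸ v ≡ u
oneWay-cancel .0 v (inj₁ refl) = 0∸n≡0 v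
oneWay-cancel u .0 (inj₂ refl) = refl

mutate-out : ∀ {m} (k b : Fin m) (R : Quiver m) → mutate k R k b ≡ R b k
mutate-out k b R with k ≟ k | b ≟ k
... | yes _  | _ = refl
... | no k≢k | _ = contradiction refl k≢k

mutate-in : ∀ {m} (k a : Fin m) (R : Quiver m) → mutate k R a k ≡ R k a
mutate-in k a R with a ≟ k | k ≟ k
... | yes _ | _      = refl
... | no _  | yes _  = refl
... | no _  | no k≢k = contradiction refl k≢k

mutate-away : ∀ {m} {k a b : Fin m} (R : Quiver m) → a ≢ k → b ≢ k →
  mutate k R a b ≡ (R a b + R a k * R k b) ∸ (R b a + R b k * R k a)
mutate-away {k = k} {a} {b} R a≢k b≢k with a ≟ k | b ≟ k
... | yes a≡k | _       = contradiction a≡k a≢k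
... | no _    | yes b≡k = contradiction b≡k b≢k
... | no _    | no _    = refl

mutate-unchanged : ∀ {m} {k a b : Fin m} (R : Quiver m) → a ≢ k → b ≢ k →
  NoPathVia R a k b → NoPathVia R b k a → OneWay R a b → mutate k R a b ≡ R a b
mutate-unchanged {k = k} {a} {b} R a≢k b≢k akb bka oneWay = begin
  mutate k R a b                                     ≡⟨ mutate-away R a≢k b≢k ⟩
  (R a b + R a k * R k b) ∸ (R b a + R b k * R k a)  ≡⟨ cong₂ (λ x y → (R a b + x) ∸ (R b a + y))
                                                          (noPath⇒no-composites R a k b akb) (noPath⇒no-composites R b k a bka) ⟩
  (R a b + 0) ∸ (R b a + 0)                          ≡⟨ cong₂ _∸_ (+-identityʳ (R a b)) (+-identityʳ (R b a)) ⟩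
  R a b ∸ R b a                                      ≡⟨ oneWay-cancel (R a b) (R b a) oneWay ⟩
  R a b                                              ∎

mutate-zero : ∀ {m} {k a b : Fin m} (R : Quiver m) → a ≢ k → b ≢ k →
  R a b ≡ 0 → NoPathVia R a k b → mutate k R a b ≡ 0
mutate-zero {k = k} {a} {b} R a≢k b≢k ab≡0 akb = begin
  mutate k R a b                                     ≡⟨ mutate-away R a≢k b≢k ⟩
  (R a b + R a k * R k b) ∸ (R b a + R b k * R k a)  ≡⟨ cong (_∸ (R b a + R b k * R k a))
                                                          (cong₂ _+_ ab≡0 (noPath⇒no-composites R a k b akb)) ⟩
  0 ∸ (R b a + R b k * R k a)                        ≡⟨ 0∸n≡0 (R b a + R b k * R k a) ⟩
  0                                                  ∎

mutate-composite : ∀ {m} {k a b : Fin m} (R : Quiver m) → a ≢ k → b ≢ k →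
  R a b ≡ 0 → R b a ≡ 0 → NoPathVia R b k a → mutate k R a b ≡ R a k * R k b
mutate-composite {k = k} {a} {b} R a≢k b≢k ab≡0 ba≡0 bka = begin
  mutate k R a b                                     ≡⟨ mutate-away R a≢k b≢k ⟩
  (R a b + R a k * R k b) ∸ (R b a + R b k * R k a)  ≡⟨ cong₂ (λ x y → (x + R a k * R k b) ∸ y)
                                                          ab≡0 (cong₂ _+_ ba≡0 (noPath⇒no-composites R b k a bka)) ⟩
  R a k * R k b                                      ∎

acyclic⇒oneWay : ∀ {n} {Q : Quiver n} → Acyclic Q → ∀ a b → OneWay Q a b
acyclic⇒oneWay {Q = Q} acyclic a b with Q a b ≟ℕ 0 | Q b a ≟ℕ 0
... | yes ab≡0 | _        = inj₁ ab≡0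
... | no _     | yes ba≡0 = inj₂ ba≡0
... | no ab≢0  | no ba≢0  = ⊥-elim (acyclic a (cons (n≢0⇒n>0 ab≢0) (edge (n≢0⇒n>0 ba≢0))))

HasPredIn : ∀ {n} → Quiver n → Subset n → Fin n → Set
HasPredIn Q U j = ∃ λ i → i ∈ U × 0 < Q i j

hasPredIn? : ∀ {n} (Q : Quiver n) (U : Subset n) (j : Fin n) → Dec (HasPredIn Q U j)
hasPredIn? Q U j = any? (λ i → (i ∈? U) ×-dec (0 <? Q i j))

source⇒no-arrows : ∀ {n} {Q : Quiver n} {U : Subset n} {j : Fin n} →
  ¬ HasPredIn Q U j → ∀ i → i ∈ U → Q i j ≡ 0
source⇒no-arrows {Q = Q} {j = j} noPred i i∈U with Q i j ≟ℕ 0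
... | yes ij≡0 = ij≡0
... | no ij≢0  = contradiction (i , i∈U , n≢0⇒n>0 ij≢0) noPred

-- In an acyclic quiver, a set in which every vertex has a predecessor is empty:
-- walking backwards n steps inside it would revisit a vertex and close a cycle.
pred-closed⇒empty : ∀ {n} {Q : Quiver n} {U : Subset n} → Acyclic Q →
  (∀ j → j ∈ U → HasPredIn Q U j) → Empty U
pred-closed⇒empty {n} {Q} {U} acyclic pred (u , u∈U) = cycle (pigeonhole (n<1+n n) (λ t → vertex (toℕ t)))
  where
  walk : ℕ → Σ (Fin n) (_∈ U)
  walk zero    = u , u∈U
  walk (suc k) = proj₁ (pred _ (proj₂ (walk k))) , proj₁ (proj₂ (pred _ (proj₂ (walk k))))

  vertex : ℕ → Fin n
  vertex k = proj₁ (walk k)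

  arrow : ∀ k → 0 < Q (vertex (suc k)) (vertex k)
  arrow k = proj₂ (proj₂ (pred _ (proj₂ (walk k))))

  walk-path : ∀ k {k′} → k < k′ → Path Q (vertex k′) (vertex k)
  walk-path k {suc k′} k<1+k′ with m<1+n⇒m<n∨m≡n k<1+k′
  ... | inj₁ k<k′ = cons (arrow k′) (walk-path k k<k′)
  ... | inj₂ refl = edge (arrow k)

  cycle : (∃₂ λ s t → toℕ s < toℕ t × vertex (toℕ s) ≡ vertex (toℕ t)) → ⊥
  cycle (s , t , s<t , revisit) =
    acyclic (vertex (toℕ s)) (subst (λ x → Path Q x (vertex (toℕ s))) (sym revisit) (walk-path (toℕ s) s<t))

source-exists : ∀ {n} {Q : Quiver n} → Acyclic Q → (U : Subset n) → Nonempty U →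
  ∃ λ j → j ∈ U × ¬ HasPredIn Q U j
source-exists {Q = Q} acyclic U nonempty with any? (λ j → (j ∈? U) ×-dec ¬? (hasPredIn? Q U j))
... | yes source = source
... | no none    = ⊥-elim (pred-closed⇒empty acyclic hasPred nonempty)
  where
  hasPred : ∀ j → j ∈ U → HasPredIn Q U j
  hasPred j j∈U = decidable-stable (hasPredIn? Q U j) (λ noPred → none (j , j∈U , noPred))

∈-insert⁻ : ∀ {n} {P : Subset n} {j x : Fin n} → x ∈ P ∪ ⁅ j ⁆ → x ∈ P ⊎ x ≡ j
∈-insert⁻ {P = P} {j} x∈ = ⊎-map₂ (x∈⁅y⁆⇒x≡y j) (x∈p∪q⁻ P ⁅ j ⁆ x∈)

∉-insert⁻ : ∀ {n} {P : Subset n} {j x : Fin n} → x ∉ P ∪ ⁅ j ⁆ → x ∉ P × x ≢ j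
∉-insert⁻ x∉ = (λ x∈P → x∉ (x∈p∪q⁺ (inj₁ x∈P))) , (λ { refl → x∉ (x∈p∪q⁺ (inj₂ (x∈⁅x⁆ _))) })

insert-⊃ : ∀ {n} {P : Subset n} {j : Fin n} → j ∉ P → (P ∪ ⁅ j ⁆) ⊃ P
insert-⊃ {j = j} j∉P = p⊆p∪q ⁅ j ⁆ , j , x∈p∪q⁺ (inj₂ (x∈⁅x⁆ j)) , j∉P

module Framing {n : ℕ} (Q : Quiver n) where

  V G : Fin n → Fin (n + n)
  V a = a ↑ˡ n
  G l = n ↑ʳ l

  V≢G : ∀ a l → V a ≢ G l
  V≢G a l eq with trans (sym (splitAt-↑ˡ n a n)) (trans (cong (splitAt n) eq) (splitAt-↑ʳ n n l))
  ... | ()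

  V-injective : ∀ {a b} → V a ≡ V b → a ≡ b
  V-injective = ↑ˡ-injective n _ _

  G-injective : ∀ {a b} → G a ≡ G b → a ≡ b
  G-injective = ↑ʳ-injective n _ _

  frame : Fin n → Fin n → ℕ
  frame a l with a ≟ l
  ... | yes _ = 1
  ... | no _  = Q a l

  frame-diag : ∀ l → frame l l ≡ 1
  frame-diag l with l ≟ l
  ... | yes _  = refl
  ... | no l≢l = contradiction refl l≢l

  frame-off : ∀ {a l} → a ≢ l → frame a l ≡ Q a l
  frame-off {a} {l} a≢l with a ≟ l
  ... | yes a≡l = contradiction a≡l a≢l
  ... | no _    = refl

  arrowsBetween : Fin n ⊎ Fin n → Fin n ⊎ Fin n → ℕ
  arrowsBetween (inj₁ a) (inj₁ b) = 0
  arrowsBetween (inj₁ a) (inj₂ l) = frame a l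
  arrowsBetween (inj₂ l) (inj₁ b) = 0
  arrowsBetween (inj₂ l) (inj₂ m) = 0

  B : Quiver (n + n)
  B x y = arrowsBetween (splitAt n x) (splitAt n y)

  B-bipartite : Bipartite B
  B-bipartite x y z = sourcesOrSinks (splitAt n x) (splitAt n y) (splitAt n z)
    where
    sourcesOrSinks : ∀ s t u → arrowsBetween s t ≡ 0 ⊎ arrowsBetween t u ≡ 0
    sourcesOrSinks (inj₁ _) (inj₁ _) _        = inj₁ refl
    sourcesOrSinks (inj₂ _) (inj₁ _) _        = inj₁ refl
    sourcesOrSinks _        (inj₂ _) (inj₁ _) = inj₂ refl
    sourcesOrSinks _        (inj₂ _) (inj₂ _) = inj₂ refl

  B-VV : ∀ a b → B (V a) (V b) ≡ 0
  B-VV a b = cong₂ arrowsBetween (splitAt-↑ˡ n a n) (splitAt-↑ˡ n b n)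

  B-VG : ∀ a l → B (V a) (G l) ≡ frame a l
  B-VG a l = cong₂ arrowsBetween (splitAt-↑ˡ n a n) (splitAt-↑ʳ n n l)

  B-GV : ∀ l a → B (G l) (V a) ≡ 0
  B-GV l a = cong₂ arrowsBetween (splitAt-↑ʳ n n l) (splitAt-↑ˡ n a n)

  B-GG : ∀ l l′ → B (G l) (G l′) ≡ 0
  B-GG l l′ = cong₂ arrowsBetween (splitAt-↑ʳ n n l) (splitAt-↑ʳ n n l′)

  -- The quiver R reached after processing the predecessor-closed set P: the copies
  -- of processed vertices carry Q, the frozen partners of processed vertices are
  -- unconstrained, and each pending G l still looks as in B except that it now has
  -- Q i l arrows from processed V i, pointing the other way.
  record Stage (P : Subset n) (R : Quiver (n + n)) : Set where
    field
      closed      : ∀ a b → a ∉ P → b ∈ P → Q a b ≡ 0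
      VV-done     : ∀ a b → a ∈ P → b ∈ P → R (V a) (V b) ≡ Q a b
      VV-pendingˡ : ∀ a b → a ∉ P → R (V a) (V b) ≡ 0
      VV-pendingʳ : ∀ a b → b ∉ P → R (V a) (V b) ≡ 0
      VG-done     : ∀ i l → i ∈ P → l ∉ P → R (V i) (G l) ≡ 0
      GV-done     : ∀ i l → i ∈ P → l ∉ P → R (G l) (V i) ≡ Q i l
      VG-pending  : ∀ i l → i ∉ P → l ∉ P → i ≢ l → R (V i) (G l) ≡ Q i l
      VG-frame    : ∀ l → l ∉ P → R (V l) (G l) ≡ 1
      GV-pending  : ∀ i l → i ∉ P → l ∉ P → R (G l) (V i) ≡ 0
      GG          : ∀ l l′ → l ∉ P → l′ ∉ P → R (G l) (G l′) ≡ 0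

  initial : Stage ∅ B
  initial = record
    { closed      = λ _ _ _ b∈∅ → contradiction b∈∅ ∉⊥
    ; VV-done     = λ _ _ a∈∅ _ → contradiction a∈∅ ∉⊥
    ; VV-pendingˡ = λ a b _ → B-VV a b
    ; VV-pendingʳ = λ a b _ → B-VV a b
    ; VG-done     = λ _ _ i∈∅ _ → contradiction i∈∅ ∉⊥
    ; GV-done     = λ _ _ i∈∅ _ → contradiction i∈∅ ∉⊥
    ; VG-pending  = λ i l _ _ i≢l → trans (B-VG i l) (frame-off i≢l)
    ; VG-frame    = λ l _ → trans (B-VG l l) (frame-diag l)
    ; GV-pending  = λ i l _ _ → B-GV l i
    ; GG          = λ l l′ _ _ → B-GG l l′
    }

  module Step (oneWay : ∀ a b → OneWay Q a b) {P : Subset n} {R : Quiver (n + n)}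
              (stage : Stage P R) (j : Fin n) (j∉P : j ∉ P)
              (source : ∀ i → i ∉ P → Q i j ≡ 0) where
    open Stage stage

    R₁ R₂ : Quiver (n + n)
    R₁ = mutate (G j) R
    R₂ = mutate (V j) R₁

    VV-oneWay : ∀ a b → OneWay R (V a) (V b)
    VV-oneWay a b with a ∈? P | b ∈? P
    ... | yes a∈P | yes b∈P = ⊎-map (trans (VV-done a b a∈P b∈P)) (trans (VV-done b a b∈P a∈P)) (oneWay a b)
    ... | no a∉P  | _       = inj₁ (VV-pendingˡ a b a∉P)
    ... | yes _   | no b∉P  = inj₁ (VV-pendingʳ a b b∉P)

    VG-oneWay : ∀ i l → l ∉ P → OneWay R (V i) (G l)
    VG-oneWay i l l∉P with i ∈? P
    ... | yes i∈P = inj₁ (VG-done i l i∈P l∉P)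
    ... | no i∉P  = inj₂ (GV-pending i l i∉P l∉P)

    -- The vertices, other than V j and the processed G l, whose mutual arrows
    -- both mutations leave unchanged.
    data Kept : Fin (n + n) → Set where
      copy   : ∀ {a} → a ≢ j → Kept (V a)
      frozen : ∀ {l} → l ∉ P → l ≢ j → Kept (G l)

    kept≢Gj : ∀ {x} → Kept x → x ≢ G j
    kept≢Gj (copy {a} _)      = V≢G a j
    kept≢Gj (frozen _ l≢j) eq = l≢j (G-injective eq)

    kept≢Vj : ∀ {x} → Kept x → x ≢ V j
    kept≢Vj (copy a≢j) eq       = a≢j (V-injective eq)
    kept≢Vj (frozen {l} _ _) eq = V≢G j l (sym eq)

    kept-oneWay : ∀ {x y} → Kept x → Kept y → OneWay R x y
    kept-oneWay (copy {a} _)       (copy {b} _)        = VV-oneWay a b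
    kept-oneWay (copy {i} _)       (frozen {l} l∉P _)  = VG-oneWay i l l∉P
    kept-oneWay (frozen {l} l∉P _) (copy {i} _)        = swap (VG-oneWay i l l∉P)
    kept-oneWay (frozen {l} l∉P _) (frozen {l′} l′∉P _) = inj₁ (GG l l′ l∉P l′∉P)

    -- Since j is a source of the pending vertices, no kept vertex has arrows to G j;
    -- hence mutation at G j leaves the arrows between kept vertices alone.
    kept↛Gj : ∀ {x} → Kept x → R x (G j) ≡ 0
    kept↛Gj (copy {a} a≢j) with a ∈? P
    ... | yes a∈P = VG-done a j a∈P j∉P
    ... | no a∉P  = trans (VG-pending a j a∉P j∉P a≢j) (source a a∉P)
    kept↛Gj (frozen {l} l∉P _) = GG l j l∉P j∉P

    R₁-kept : ∀ {x y} → Kept x → Kept y → R₁ x y ≡ R x y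
    R₁-kept kx ky = mutate-unchanged R (kept≢Gj kx) (kept≢Gj ky)
      (inj₁ (kept↛Gj kx)) (inj₁ (kept↛Gj ky)) (kept-oneWay kx ky)

    R₁-out-of-Vj : ∀ a → R₁ (V j) (V a) ≡ R (G j) (V a)
    R₁-out-of-Vj a = begin
      R₁ (V j) (V a)                ≡⟨ mutate-composite R (V≢G j j) (V≢G a j) (VV-pendingˡ j a j∉P)
                                        (VV-pendingʳ a j j∉P) (inj₂ (GV-pending j j j∉P j∉P)) ⟩
      R (V j) (G j) * R (G j) (V a) ≡⟨ cong (_* R (G j) (V a)) (VG-frame j j∉P) ⟩
      1 * R (G j) (V a)             ≡⟨ *-identityˡ _ ⟩
      R (G j) (V a)                 ∎

    R₁-Vj-frozen : ∀ l → l ∉ P → l ≢ j → R₁ (V j) (G l) ≡ R (V j) (G l)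
    R₁-Vj-frozen l l∉P l≢j = mutate-unchanged R (V≢G j j) (λ eq → l≢j (G-injective eq))
      (inj₂ (GG j l j∉P l∉P)) (inj₁ (GG l j l∉P j∉P)) (VG-oneWay j l l∉P)

    R₁-into-Vj : ∀ a → R₁ (V a) (V j) ≡ 0
    R₁-into-Vj a = mutate-zero R (V≢G a j) (V≢G j j) (VV-pendingʳ a j j∉P)
      (inj₂ (GV-pending j j j∉P j∉P))

    kept↛Vj : ∀ {x} → Kept x → R₁ x (V j) ≡ 0
    kept↛Vj (copy {a} _) = R₁-into-Vj a
    kept↛Vj (frozen {l} l∉P l≢j) = trans
      (mutate-unchanged R (λ eq → l≢j (G-injective eq)) (V≢G j j)
        (inj₁ (GG l j l∉P j∉P)) (inj₂ (GG j l j∉P l∉P)) (swap (VG-oneWay j l l∉P)))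
      (GV-pending j l j∉P l∉P)

    R₂-kept : ∀ {x y} → Kept x → Kept y → R₂ x y ≡ R x y
    R₂-kept kx ky = trans
      (mutate-unchanged R₁ (kept≢Vj kx) (kept≢Vj ky) (inj₁ (kept↛Vj kx)) (inj₁ (kept↛Vj ky))
        (⊎-map (trans (R₁-kept kx ky)) (trans (R₁-kept ky kx)) (kept-oneWay kx ky)))
      (R₁-kept kx ky)

    P′ : Subset n
    P′ = P ∪ ⁅ j ⁆

    done′ : ∀ {x} → x ∈ P′ → x ≡ j ⊎ (x ∈ P × x ≢ j)
    done′ x∈P′ with ∈-insert⁻ x∈P′
    ... | inj₁ x∈P = inj₂ (x∈P , λ { refl → j∉P x∈P })
    ... | inj₂ x≡j = inj₁ x≡j

    wasPending : ∀ {x} → x ∉ P′ → x ∉ P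
    wasPending x∉P′ = proj₁ (∉-insert⁻ x∉P′)

    keptCopy : ∀ {a} → a ∉ P′ → Kept (V a)
    keptCopy a∉P′ = copy (proj₂ (∉-insert⁻ a∉P′))

    keptFrozen : ∀ {l} → l ∉ P′ → Kept (G l)
    keptFrozen l∉P′ = let (l∉P , l≢j) = ∉-insert⁻ l∉P′ in frozen l∉P l≢j

    stage′ : Stage P′ R₂
    stage′ = record
      { closed      = closed′
      ; VV-done     = VV-done′
      ; VV-pendingˡ = VV-pendingˡ′
      ; VV-pendingʳ = VV-pendingʳ′
      ; VG-done     = VG-done′
      ; GV-done     = GV-done′
      ; VG-pending  = λ i l i∉ l∉ i≢l → trans (R₂-kept (keptCopy i∉) (keptFrozen l∉))
                        (VG-pending i l (wasPending i∉) (wasPending l∉) i≢l)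
      ; VG-frame    = λ l l∉ → trans (R₂-kept (keptCopy l∉) (keptFrozen l∉)) (VG-frame l (wasPending l∉))
      ; GV-pending  = λ i l i∉ l∉ → trans (R₂-kept (keptFrozen l∉) (keptCopy i∉))
                        (GV-pending i l (wasPending i∉) (wasPending l∉))
      ; GG          = λ l l′ l∉ l′∉ → trans (R₂-kept (keptFrozen l∉) (keptFrozen l′∉))
                        (GG l l′ (wasPending l∉) (wasPending l′∉))
      }
      where
      closed′ : ∀ a b → a ∉ P′ → b ∈ P′ → Q a b ≡ 0
      closed′ a b a∉ b∈ with done′ b∈
      ... | inj₁ refl      = source a (wasPending a∉)
      ... | inj₂ (b∈P , _) = closed a b (wasPending a∉) b∈P

      -- The arrows between V j and processed copies are reversed composites, i.e. Q's.
      VV-done′ : ∀ a b → a ∈ P′ → b ∈ P′ → R₂ (V a) (V b) ≡ Q a b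
      VV-done′ a b a∈ b∈ with done′ a∈ | done′ b∈
      ... | inj₁ refl        | inj₁ refl =
        trans (mutate-out (V j) (V j) R₁) (trans (R₁-into-Vj j) (sym (source j j∉P)))
      ... | inj₁ refl        | inj₂ (b∈P , _) =
        trans (mutate-out (V j) (V b) R₁) (trans (R₁-into-Vj b) (sym (closed j b j∉P b∈P)))
      ... | inj₂ (a∈P , _)   | inj₁ refl =
        trans (mutate-in (V j) (V a) R₁) (trans (R₁-out-of-Vj a) (GV-done a j a∈P j∉P))
      ... | inj₂ (a∈P , a≢j) | inj₂ (b∈P , b≢j) =
        trans (R₂-kept (copy a≢j) (copy b≢j)) (VV-done a b a∈P b∈P)

      VV-pendingˡ′ : ∀ a b → a ∉ P′ → R₂ (V a) (V b) ≡ 0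
      VV-pendingˡ′ a b a∉ with b ≟ j
      ... | yes refl = trans (mutate-in (V j) (V a) R₁)
                         (trans (R₁-out-of-Vj a) (GV-pending a j (wasPending a∉) j∉P))
      ... | no b≢j   = trans (R₂-kept (keptCopy a∉) (copy b≢j)) (VV-pendingˡ a b (wasPending a∉))

      VV-pendingʳ′ : ∀ a b → b ∉ P′ → R₂ (V a) (V b) ≡ 0
      VV-pendingʳ′ a b b∉ with a ≟ j
      ... | yes refl = trans (mutate-out (V j) (V b) R₁) (R₁-into-Vj b)
      ... | no a≢j   = trans (R₂-kept (copy a≢j) (keptCopy b∉)) (VV-pendingʳ a b (wasPending b∉))

      VG-done′ : ∀ i l → i ∈ P′ → l ∉ P′ → R₂ (V i) (G l) ≡ 0
      VG-done′ i l i∈ l∉ with done′ i∈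
      ... | inj₁ refl        = trans (mutate-out (V j) (G l) R₁) (kept↛Vj (keptFrozen l∉))
      ... | inj₂ (i∈P , i≢j) = trans (R₂-kept (copy i≢j) (keptFrozen l∉)) (VG-done i l i∈P (wasPending l∉))

      GV-done′ : ∀ i l → i ∈ P′ → l ∉ P′ → R₂ (G l) (V i) ≡ Q i l
      GV-done′ i l i∈ l∉ with done′ i∈ | ∉-insert⁻ l∉
      ... | inj₁ refl        | l∉P , l≢j = begin
        R₂ (G l) (V j)  ≡⟨ mutate-in (V j) (G l) R₁ ⟩
        R₁ (V j) (G l)  ≡⟨ R₁-Vj-frozen l l∉P l≢j ⟩
        R (V j) (G l)   ≡⟨ VG-pending j l j∉P l∉P (λ j≡l → l≢j (sym j≡l)) ⟩
        Q j l           ∎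
      ... | inj₂ (i∈P , i≢j) | l∉P , l≢j =
        trans (R₂-kept (frozen l∉P l≢j) (copy i≢j)) (GV-done i l i∈P l∉P)

  module Iteration (acyclic : Acyclic Q) where

    process : ∀ P → Acc _⊃_ P → ∀ {R} → Stage P R → MutEquiv B R →
      Σ (Quiver (n + n)) λ R′ → MutEquiv B R′ × (∀ a b → R′ (V a) (V b) ≡ Q a b)
    process P (acc larger) {R} stage B~R with nonempty? (∁ P)
    ... | no allDone = R , B~R , λ a b → Stage.VV-done stage a b (done a) (done b)
      where
      done : ∀ a → a ∈ P
      done a = x∉∁p⇒x∈p (λ a∈∁P → allDone (a , a∈∁P))
    ... | yes pending with source-exists acyclic (∁ P) pending
    ...   | j , j∈∁P , noPred =
      process (P ∪ ⁅ j ⁆) (larger (insert-⊃ j∉P))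
        (Step.stage′ (acyclic⇒oneWay acyclic) stage j j∉P source)
        (mutStep (V j) (mutStep (G j) B~R))
      where
      j∉P : j ∉ P
      j∉P = x∈∁p⇒x∉p j∈∁P
      source : ∀ i → i ∉ P → Q i j ≡ 0
      source i i∉P = source⇒no-arrows {Q = Q} noPred i (x∉p⇒x∈∁p i∉P)

    realise : Σ (Quiver (n + n)) λ R → MutEquiv B R × (∀ a b → R (V a) (V b) ≡ Q a b)
    realise = process ∅ (⊃-wellFounded ∅) initial same

mainTheorem1 : (n : ℕ) (Q : Quiver n) → Acyclic Q →
    Σ ℕ λ m → Σ (Quiver m) λ R → Σ (Quiver m) λ B →
    Bipartite B × MutEquiv B R × FullSubquiver Q R
mainTheorem1 n Q acyclic =
  let (R , B~R , V-carries-Q) = Iteration.realise acyclic in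
  n + n , R , B , B-bipartite , B~R , (V , V-injective , λ a b → sym (V-carries-Q a b))
  where open Framing Q
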